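{- Every connected permutation graph has a multi-chain ordering.
   Context: A permutation graph is a graph with vertex set $\{x_1,\dots,x_n\}$ and edge set $\{x_ix_j: i<j,\ \pi(i)<\pi(j)\}$ for some permutation $\pi$ of $\{1,\dots,n\}$ (equivalently, a simple graph that is both a comparability graph and a cocomparability graph). A chain graph is a bipartite graph (with given sides) containing no induced $2K_2$. For a connected graph $G$ and vertex $v_0$, the distance layers are $L_0=\{v_0\},L_1,\dots,L_z$ with $L_i$ the set of vertices at distance $i$ from $v_0$ and $z$ maximal with $L_z\ne\emptyset$. They form a multi-chain ordering if for each $0\le i<z$ the bipartite graph with sides $L_i,L_{i+1}$ and the edges of $G$ between them is a chain graph. A connected graph has a multi-chain ordering if such $v_0$ exists. -}

module Defs where

open import Level using (0ℓ)
open import Data.Nat using (ℕ; zero; suc; _<_)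
open import Data.Fin using (Fin) renaming (_<_ to _<ᶠ_)
open import Data.Fin.Permutation using (Permutation′; _⟨$⟩ʳ_)
open import Data.Product using (Σ; ∃; _×_; _,_)
open import Data.Sum using (_⊎_)
open import Relation.Nullary using (¬_)
open import Function.Bundles using (_⇔_)

record Graph (n : ℕ) : Set₁ where
  field
    Adj   : Fin n → Fin n → Set
    sym   : ∀ {u v} → Adj u v → Adj v u
    irrefl : ∀ {u} → ¬ Adj u u
open Graph public

-- Permutation graph (paper's definition, vertex x_i = i):
-- x_i x_j is an edge iff i<j and π(i)<π(j) (in either orientation).
IsPermutationGraph : ∀ {n} → Graph n → Set
IsPermutationGraph {n} G =
  Σ (Permutation′ n) λ π → ∀ i j →
    Adj G i j ⇔ ((i <ᶠ j × (π ⟨$⟩ʳ i) <ᶠ (π ⟨$⟩ʳ j)) ⊎ (j <ᶠ i × (π ⟨$⟩ʳ j) <ᶠ (π ⟨$⟩ʳ i)))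

data Walk {n} (G : Graph n) : Fin n → Fin n → ℕ → Set where
  nil  : ∀ {u} → Walk G u u zero
  cons : ∀ {u w v k} → Adj G u w → Walk G w v k → Walk G u v (suc k)

Connected : ∀ {n} → Graph n → Set
Connected {n} G = Fin n × (∀ u v → ∃ λ k → Walk G u v k)

Dist : ∀ {n} → Graph n → Fin n → Fin n → ℕ → Set
Dist G u v k = Walk G u v k × (∀ m → m < k → ¬ Walk G u v m)

InLayer : ∀ {n} → Graph n → Fin n → ℕ → Fin n → Set
InLayer G v0 i v = Dist G v0 v i

-- The bipartite graph with sides A, B (edges of G between them) is a chain
-- graph: it contains no induced 2K2.
IsChainGraph : ∀ {n} → Graph n → (Fin n → Set) → (Fin n → Set) → Set
IsChainGraph {n} G A B =
  ¬ (Σ (Fin n) λ a₁ → Σ (Fin n) λ a₂ → Σ (Fin n) λ b₁ → Σ (Fin n) λ b₂ →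
       A a₁ × A a₂ × B b₁ × B b₂ ×
       Adj G a₁ b₁ × Adj G a₂ b₂ × ¬ Adj G a₁ b₂ × ¬ Adj G a₂ b₁)

-- The distance layers from v0 form a multi-chain ordering.
-- (For i ≥ z the layer L_{i+1} is empty, so quantifying over all i is the same
-- as over 0 ≤ i < z.)
IsMultiChainOrdering : ∀ {n} → Graph n → Fin n → Set
IsMultiChainOrdering G v0 =
  ∀ i → IsChainGraph G (InLayer G v0 i) (InLayer G v0 (suc i))

HasMultiChainOrdering : ∀ {n} → Graph n → Set
HasMultiChainOrdering {n} G = Σ (Fin n) λ v0 → IsMultiChainOrdering G v0

-- A permutation graph is the comparability graph of a two-dimensional poset:
-- i ~ j iff the two linear orders ≺₁, ≺₂ of a realizer order i and j the same
-- way. Root the layers at the ≺₁-least vertex. Inductively, every vertex of L_k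
-- is ≺₁-below every vertex farther than k: a vertex a ∈ L_{k+1} has a neighbour
-- p ∈ L_k that is adjacent to no vertex c farther than k+1, and p ≺₁ a, p ≺₁ c
-- then force p ≺₂ a and p ⊀₂ c, so c ≺₂ a. So the statement for k+1 holds for
-- the realizer (≻₂, ≻₁) of the same graph. Between L_k and L_{k+1} adjacency is
-- therefore just ≺₂, whose up-sets are nested, so no induced 2K₂ can occur.
module Submission where

open import Level using (0ℓ)
open import Data.Nat using (ℕ; zero; suc; z≤n; s≤s; z<s) renaming (_≤_ to _≤ℕ_)
open import Data.Nat.Properties using (≤-refl; m≤n⇒m≤1+n)
open import Data.Fin using (Fin; _<_) renaming (zero to fzero; suc to fsuc)
open import Data.Fin.Properties using (<-isStrictTotalOrder)
open import Data.Fin.Permutation using (_⟨$⟩ʳ_)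
open import Data.Product using (∃; ∃-syntax; _×_; _,_; swap)
open import Data.Sum using (_⊎_; inj₁; inj₂) renaming (swap to ⊎-swap; map to ⊎-map)
open import Data.Empty using (⊥)
open import Function.Base using (flip; _on_; id)
open import Function.Bundles using (_⇔_; mk⇔; Equivalence; Injection)
open import Function.Properties.Inverse using (↔⇒↣)
open import Relation.Binary.Core using (Rel)
open import Relation.Binary.Definitions using (tri<; tri≈; tri>)
open import Relation.Binary.Structures using (IsStrictTotalOrder)
open import Relation.Binary.Morphism.Structures using (IsOrderMonomorphism)
open import Relation.Nullary using (¬_; contradiction)
open import Relation.Binary.PropositionalEquality using (_≡_; _≢_; refl; cong)
import Relation.Binary.Construct.Flip.EqAndOrd as Flip
import Relation.Binary.Morphism.OrderMonomorphism as OrderMonomorphism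

open import Defs

module _ {a ℓ} {A : Set a} {_≺_ : Rel A ℓ} (isStrictTotalOrder : IsStrictTotalOrder _≡_ _≺_) where
  open IsStrictTotalOrder isStrictTotalOrder

  ≺∧⊀⇒≻ : ∀ {p a c} → p ≺ a → ¬ p ≺ c → c ≺ a
  ≺∧⊀⇒≻ {a = a} {c} p≺a p⊀c with compare c a
  ... | tri< c≺a _ _ = c≺a
  ... | tri≈ _ refl _ = contradiction p≺a p⊀c
  ... | tri> _ _ a≺c = contradiction (trans p≺a a≺c) p⊀c

  no-crossing : ∀ {a₁ a₂ b₁ b₂} → a₁ ≺ b₁ → a₂ ≺ b₂ → ¬ a₁ ≺ b₂ → ¬ a₂ ≺ b₁ → ⊥
  no-crossing {a₁} {a₂} a₁≺b₁ a₂≺b₂ a₁⊀b₂ a₂⊀b₁ with compare a₁ a₂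
  ... | tri< a₁≺a₂ _ _ = a₁⊀b₂ (trans a₁≺a₂ a₂≺b₂)
  ... | tri≈ _ refl _ = a₂⊀b₁ a₁≺b₁
  ... | tri> _ _ a₂≺a₁ = a₂⊀b₁ (trans a₂≺a₁ a₁≺b₁)

record Realizer {n : ℕ} (G : Graph n) : Set₁ where
  field
    _≺₁_ _≺₂_ : Rel (Fin n) 0ℓ
    ≺₁-isStrictTotalOrder : IsStrictTotalOrder _≡_ _≺₁_
    ≺₂-isStrictTotalOrder : IsStrictTotalOrder _≡_ _≺₂_
    Adj⇔ : ∀ i j → Adj G i j ⇔ ((i ≺₁ j × i ≺₂ j) ⊎ (j ≺₁ i × j ≺₂ i))

  private
    module ≺₁ = IsStrictTotalOrder ≺₁-isStrictTotalOrder

  Adj∧≺₁⇒≺₂ : ∀ {i j} → i ≺₁ j → Adj G i j → i ≺₂ j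
  Adj∧≺₁⇒≺₂ {i} {j} i≺₁j ij with Equivalence.to (Adj⇔ i j) ij
  ... | inj₁ (_ , i≺₂j) = i≺₂j
  ... | inj₂ (j≺₁i , _) = contradiction i≺₁j (≺₁.asym j≺₁i)

  ¬Adj∧≺₁⇒⊀₂ : ∀ {i j} → i ≺₁ j → ¬ Adj G i j → ¬ i ≺₂ j
  ¬Adj∧≺₁⇒⊀₂ {i} {j} i≺₁j ¬ij i≺₂j = ¬ij (Equivalence.from (Adj⇔ i j) (inj₁ (i≺₁j , i≺₂j)))

  dual : Realizer G
  dual = record
    { _≺₁_ = flip _≺₂_
    ; _≺₂_ = flip _≺₁_
    ; ≺₁-isStrictTotalOrder = Flip.isStrictTotalOrder ≺₂-isStrictTotalOrder
    ; ≺₂-isStrictTotalOrder = Flip.isStrictTotalOrder ≺₁-isStrictTotalOrder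
    ; Adj⇔ = λ i j → let open Equivalence (Adj⇔ i j) in
        mk⇔ (λ ij → ⊎-swap (⊎-map swap swap (to ij)))
            (λ r → from (⊎-swap (⊎-map swap swap r)))
    }

permutationGraph⇒Realizer : ∀ {n} {G : Graph n} → IsPermutationGraph G → Realizer G
permutationGraph⇒Realizer {n} (π , Adj⇔) = record
  { _≺₁_ = _<_
  ; _≺₂_ = _<_ on (π ⟨$⟩ʳ_)
  ; ≺₁-isStrictTotalOrder = <-isStrictTotalOrder
  ; ≺₂-isStrictTotalOrder = OrderMonomorphism.isStrictTotalOrder π-monomorphism <-isStrictTotalOrder
  ; Adj⇔ = Adj⇔
  }
  where
  π-monomorphism : IsOrderMonomorphism _≡_ _≡_ (_<_ on (π ⟨$⟩ʳ_)) (_<_ {n}) (π ⟨$⟩ʳ_)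
  π-monomorphism = record
    { isOrderHomomorphism = record { cong = cong (π ⟨$⟩ʳ_) ; mono = id }
    ; injective = Injection.injective (↔⇒↣ π)
    ; cancel = id
    }

module _ {n : ℕ} (G : Graph n) where

  snoc : ∀ {u v w k} → Walk G u v k → Adj G v w → Walk G u w (suc k)
  snoc nil vw = cons vw nil
  snoc (cons uu′ w) vw = cons uu′ (snoc w vw)

  unsnoc : ∀ {u w k} → Walk G u w (suc k) → ∃[ v ] Walk G u v k × Adj G v w
  unsnoc (cons uw nil) = _ , nil , uw
  unsnoc (cons uu′ (cons u′u″ w)) with unsnoc (cons u′u″ w)
  ... | v , w′ , vw = v , cons uu′ w′ , vw

  Beyond : Fin n → ℕ → Fin n → Set
  Beyond v₀ k c = ∀ m → m ≤ℕ k → ¬ Walk G v₀ c m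

  Beyond-suc⇒Beyond : ∀ {v₀ k c} → Beyond v₀ (suc k) c → Beyond v₀ k c
  Beyond-suc⇒Beyond far m m≤k = far m (m≤n⇒m≤1+n m≤k)

  InLayer-suc⇒Beyond : ∀ {v₀ k a} → InLayer G v₀ (suc k) a → Beyond v₀ k a
  InLayer-suc⇒Beyond (_ , shortest) m m≤k = shortest m (s≤s m≤k)

  InLayer-suc⇒parent : ∀ {v₀ k a} → InLayer G v₀ (suc k) a →
                       ∃[ p ] InLayer G v₀ k p × Adj G p a
  InLayer-suc⇒parent (w , shortest) with unsnoc w
  ... | p , w′ , pa = p , (w′ , λ m m<k w″ → shortest (suc m) (s≤s m<k) (snoc w″ pa)) , pa

  InLayer∧Beyond-suc⇒¬Adj : ∀ {v₀ k p c} → InLayer G v₀ k p → Beyond v₀ (suc k) c → ¬ Adj G p c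
  InLayer∧Beyond-suc⇒¬Adj (w , _) far pc = far _ ≤-refl (snoc w pc)

  LayerPrecedes : Rel (Fin n) 0ℓ → Fin n → ℕ → Set
  LayerPrecedes _≺_ v₀ k = ∀ {a c} → InLayer G v₀ k a → Beyond v₀ k c → a ≺ c

  least⇒LayerPrecedes₀ : ∀ {_≺_ v₀} → (∀ c → c ≢ v₀ → v₀ ≺ c) → LayerPrecedes _≺_ v₀ 0
  least⇒LayerPrecedes₀ least {c = c} (nil , _) far = least c λ { refl → far 0 z≤n nil }

module _ {n : ℕ} {G : Graph n} (R : Realizer G) where
  open Realizer R

  LayerPrecedes-dual : ∀ {v₀ k} → LayerPrecedes G _≺₁_ v₀ k →
                       LayerPrecedes G (flip _≺₂_) v₀ (suc k)
  LayerPrecedes-dual below a∈L far with InLayer-suc⇒parent G a∈L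
  ... | p , p∈L , pa = ≺∧⊀⇒≻ ≺₂-isStrictTotalOrder
    (Adj∧≺₁⇒≺₂ p≺₁a pa)
    (¬Adj∧≺₁⇒⊀₂ p≺₁c (InLayer∧Beyond-suc⇒¬Adj G p∈L far))
    where
    p≺₁a = below p∈L (InLayer-suc⇒Beyond G a∈L)
    p≺₁c = below p∈L (Beyond-suc⇒Beyond G far)

  LayerPrecedes⇒IsChainGraph : ∀ {v₀ k} → LayerPrecedes G _≺₁_ v₀ k →
                               IsChainGraph G (InLayer G v₀ k) (InLayer G v₀ (suc k))
  LayerPrecedes⇒IsChainGraph {v₀} {k} below
    (a₁ , a₂ , b₁ , b₂ , a₁∈L , a₂∈L , b₁∈L′ , b₂∈L′ , a₁b₁ , a₂b₂ , ¬a₁b₂ , ¬a₂b₁) =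
    no-crossing ≺₂-isStrictTotalOrder
      (Adj∧≺₁⇒≺₂ (precedes a₁∈L b₁∈L′) a₁b₁) (Adj∧≺₁⇒≺₂ (precedes a₂∈L b₂∈L′) a₂b₂)
      (¬Adj∧≺₁⇒⊀₂ (precedes a₁∈L b₂∈L′) ¬a₁b₂) (¬Adj∧≺₁⇒⊀₂ (precedes a₂∈L b₁∈L′) ¬a₂b₁)
    where
    precedes : ∀ {a b} → InLayer G v₀ k a → InLayer G v₀ (suc k) b → a ≺₁ b
    precedes a∈L b∈L′ = below a∈L (InLayer-suc⇒Beyond G b∈L′)

∃Realizer-LayerPrecedes : ∀ {n} {G : Graph n} {v₀} (R : Realizer G) →
  LayerPrecedes G (Realizer._≺₁_ R) v₀ 0 →
  ∀ k → ∃[ R′ ] LayerPrecedes G (Realizer._≺₁_ R′) v₀ k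
∃Realizer-LayerPrecedes R below₀ zero = R , below₀
∃Realizer-LayerPrecedes R below₀ (suc k) with ∃Realizer-LayerPrecedes R below₀ k
... | R′ , below = Realizer.dual R′ , LayerPrecedes-dual R′ below

-- Connectedness is used only for nonemptiness: the layers from the least vertex
-- form a multi-chain ordering of every permutation graph.
theorem1 : ∀ (n : ℕ) (G : Graph n) → IsPermutationGraph G → Connected G → HasMultiChainOrdering G
theorem1 zero G _ (() , _)
theorem1 (suc m) G isPermutation _ = fzero , λ k →
  let R′ , below = ∃Realizer-LayerPrecedes R (least⇒LayerPrecedes₀ G {_<_} fzero-least) k
  in LayerPrecedes⇒IsChainGraph R′ below
  where
  R : Realizer G
  R = permutationGraph⇒Realizer isPermutation

  fzero-least : ∀ c → c ≢ fzero → fzero {m} < c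
  fzero-least fzero c≢0 = contradiction refl c≢0
  fzero-least (fsuc c) _ = z<s
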